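{- If $\Delta$ is a 3-colored simplicial complex such that $b_1(\Delta)=0$ and $\mathcal{D}(\Delta)\neq\emptyset$, then $m(\Delta)=f_{12}(\Delta)f_{13}(\Delta)$.
   Context: A 3-colored simplicial complex is a finite simplicial complex with a coloring of its vertices by $[3]=\{1,2,3\}$ such that no face contains two vertices of the same color. $f_S(\Delta)$ is the number of faces with color set exactly $S\subseteq[3]$ (written $f_1,f_{12},f_{123}$, etc.; $f_{ij}=f_{\{i,j\}}$). Faces with color set $[3]$ are facets. Complexes are assumed to have $f_S>0$ for all $S$. Vertices of color $i$ are labeled $v^i_1,v^i_2,\dots$. Define $b_1(\Delta)=\lfloor\sqrt{f_{12}(\Delta)f_{13}(\Delta)/f_{23}(\Delta)}\rfloor$. Construction: given $\Delta$, positive integers $g_1,g_2,g_3$ and distinct $p,q\in[3]$, build $\Gamma$ as follows. Start with vertices $v^i_1,\dots,v^i_{g_i}$ for each $i$, every two of distinct colors adjacent. If $f_p(\Delta)>g_p$, add $v^p_{g_p+1}$ and, for each color $c\ne p$, join it to the first $k_c$ present vertices of color $c$, with $k_c$ as large as possible so that the number of edges of color set $\{p,c\}$ does not exceed $f_{pc}(\Delta)$. Then, if $f_q(\Delta)>g_q$, add $v^q_{g_q+1}$ and join it in the same way (the present vertices of color $p$ including $v^p_{g_p+1}$ if added). Faces: empty set, vertices, edges, all triples of pairwise adjacent vertices. Write $g_i(\Gamma),p(\Gamma),q(\Gamma)$ for the parameters. $\mathcal{A}(\Delta)$ is the set of all complexes (with parameters) so constructed that are well defined and satisfy $f_S(\Gamma)\le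 f_S(\Delta)$ for all $S\ne[3]$. $m(\Delta)=\max\{f_{123}(\Gamma):\Gamma\in\mathcal{A}(\Delta)\}$; $\mathcal{B}(\Delta)=\{\Gamma\in\mathcal{A}(\Delta):f_{123}(\Gamma)=m(\Delta)\}$; $n(\Delta)=\max\{f_{12}(\Gamma)+f_{13}(\Gamma)+f_{23}(\Gamma):\Gamma\in\mathcal{B}(\Delta)\}$; $\mathcal{C}(\Delta)=\{\Gamma\in\mathcal{B}(\Delta):f_{12}(\Gamma)+f_{13}(\Gamma)+f_{23}(\Gamma)=n(\Delta)\}$; $\mathcal{D}(\Delta)=\{\Gamma\in\mathcal{C}(\Delta): f_{123}(\Gamma)<\min\{f_1(\Delta)f_{23}(\Delta),f_2(\Delta)f_{13}(\Delta),f_3(\Delta)f_{12}(\Delta)\}\}$. -}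

module Defs where

open import Data.Nat using (ℕ; zero; suc; _+_; _*_; _∸_; _≤_; _<_; _⊓_; _<ᵇ_; _≤ᵇ_)
open import Data.Fin using (Fin; toℕ) renaming (zero to f0; suc to fs)
open import Data.Fin.Properties using () renaming (_≟_ to _≟ᶠ_)
open import Data.Maybe using (Maybe; just; nothing)
open import Data.Bool using (Bool; true; false; if_then_else_; _∧_; _∨_)
open import Data.Product using (Σ; ∃; _×_; _,_)
open import Relation.Nullary using (¬_; does)
open import Relation.Binary.PropositionalEquality using (_≡_; _≢_)

sumFin : (n : ℕ) → (Fin n → ℕ) → ℕ
sumFin zero    f = 0
sumFin (suc n) f = f f0 + sumFin n (λ i → f (fs i))

-- sum over the "slot" of one colour: if the colour is in S, sum over all
-- vertices of that colour; otherwise the slot is empty (nothing).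
sumOpt : Bool → (n : ℕ) → (Maybe (Fin n) → ℕ) → ℕ
sumOpt false n g = g nothing
sumOpt true  n g = sumFin n (λ i → g (just i))

c0 c1 c2 : Fin 3
c0 = f0
c1 = fs f0
c2 = fs (fs f0)

eqᶠ : Fin 3 → Fin 3 → Bool
eqᶠ a b = does (a ≟ᶠ b)

ColorSet : Set
ColorSet = Fin 3 → Bool

single : Fin 3 → ColorSet
single i c = eqᶠ c i

pair : Fin 3 → Fin 3 → ColorSet
pair i j c = eqᶠ c i ∨ eqᶠ c j

full : ColorSet
full _ = true

-- A (possible) face of a 3-coloured complex with n₁,n₂,n₃ vertices of the
-- three colours: at most one vertex of each colour (nothing = no vertex).
FaceFn : ℕ → ℕ → ℕ → Set
FaceFn n₁ n₂ n₃ = Maybe (Fin n₁) → Maybe (Fin n₂) → Maybe (Fin n₃) → Bool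

count : ∀ {n₁ n₂ n₃} → FaceFn n₁ n₂ n₃ → ColorSet → ℕ
count {n₁} {n₂} {n₃} F S =
  sumOpt (S c0) n₁ λ x → sumOpt (S c1) n₂ λ y → sumOpt (S c2) n₃ λ z →
  (if F x y z then 1 else 0)

data Sub {A : Set} : Maybe A → Maybe A → Set where
  none : ∀ {x} → Sub nothing x
  same : ∀ {a} → Sub (just a) (just a)

-- A finite 3-coloured simplicial complex; vertices of colour i are
-- v^i_1 … v^i_{n_i} (here indices 0 … n_i - 1).
record Complex3 : Set where
  field
    n₁ n₂ n₃ : ℕ
    face : FaceFn n₁ n₂ n₃
    down-closed : ∀ {x y z x′ y′ z′} → Sub x′ x → Sub y′ y → Sub z′ z →
                  face x y z ≡ true → face x′ y′ z′ ≡ true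
    vert₁ : ∀ i → face (just i) nothing nothing ≡ true
    vert₂ : ∀ i → face nothing (just i) nothing ≡ true
    vert₃ : ∀ i → face nothing nothing (just i) ≡ true

open Complex3 public

f : Complex3 → ColorSet → ℕ
f Δ S = count (face Δ) S

AllPositive : Complex3 → Set
AllPositive Δ = ∀ S → 0 < f Δ S

sqrtSearch : ℕ → ℕ → ℕ → ℕ
sqrtSearch a d zero    = 0
sqrtSearch a d (suc n) =
  if (suc n * suc n * d ≤ᵇ a) then suc n else sqrtSearch a d n

-- ⌊ √(a / d) ⌋ for d ≥ 1
floorSqrtDiv : ℕ → ℕ → ℕ
floorSqrtDiv a d = sqrtSearch a d a

b₁ : Complex3 → ℕ
b₁ Δ = floorSqrtDiv (f Δ (pair c0 c1) * f Δ (pair c0 c2)) (f Δ (pair c1 c2))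

record Params : Set where
  field
    g : Fin 3 → ℕ
    p q : Fin 3

open Params public

[_]ᵇ : Bool → ℕ
[ true ]ᵇ = 1
[ false ]ᵇ = 0

module Construction (Δ : Complex3) (P : Params) where
  fv : Fin 3 → ℕ
  fv i = f Δ (single i)

  fe : Fin 3 → Fin 3 → ℕ
  fe i j = f Δ (pair i j)

  G : Fin 3 → ℕ
  G = g P
  pp qq : Fin 3
  pp = p P
  qq = q P

  -- is v^p_{g_p+1} (resp. v^q_{g_q+1}) added?
  addP addQ : Bool
  addP = G pp <ᵇ fv pp
  addQ = G qq <ᵇ fv qq

  nΓ : Fin 3 → ℕ
  nΓ c = G c + (if eqᶠ c pp then [ addP ]ᵇ else if eqᶠ c qq then [ addQ ]ᵇ else 0)

  -- k_c for the new p-vertex: largest k ≤ (present vertices of colour c)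
  -- with (current {p,c}-edges) + k ≤ f_{pc}(Δ)
  kP : Fin 3 → ℕ
  kP c = G c ⊓ (fe pp c ∸ G pp * G c)

  -- number of {p,q}-edges after the first step
  Epq : ℕ
  Epq = G pp * G qq + (if addP then kP qq else 0)

  presentQ : Fin 3 → ℕ
  presentQ c = G c + (if eqᶠ c pp ∧ addP then 1 else 0)

  kQ : Fin 3 → ℕ
  kQ c = presentQ c ⊓ (fe qq c ∸ (if eqᶠ c pp then Epq else G qq * G c))

  -- adjacency of vertex number a (0-based) of colour c and vertex number b
  -- of colour d (c ≠ d); index G c is the added vertex of colour c.
  adj : Fin 3 → ℕ → Fin 3 → ℕ → Bool
  adj c a d b =
    if eqᶠ d qq ∧ (G qq ≤ᵇ b) then a <ᵇ kQ c
    else if eqᶠ c qq ∧ (G qq ≤ᵇ a) then b <ᵇ kQ d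
    else if eqᶠ d pp ∧ (G pp ≤ᵇ b) then a <ᵇ kP c
    else if eqᶠ c pp ∧ (G pp ≤ᵇ a) then b <ᵇ kP d
    else true

  pairOk : ∀ {m n} → Fin 3 → Fin 3 → Maybe (Fin m) → Maybe (Fin n) → Bool
  pairOk c d (just a) (just b) = adj c (toℕ a) d (toℕ b)
  pairOk c d _ _ = true

  faceΓ : FaceFn (nΓ c0) (nΓ c1) (nΓ c2)
  faceΓ x y z = pairOk c0 c1 x y ∧ pairOk c0 c2 x z ∧ pairOk c1 c2 y z

  fΓ : ColorSet → ℕ
  fΓ S = count faceΓ S

fΓ : Complex3 → Params → ColorSet → ℕ
fΓ Δ P = Construction.fΓ Δ P

f₁₂₃Γ : Complex3 → Params → ℕ
f₁₂₃Γ Δ P = fΓ Δ P full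

edgeSumΓ : Complex3 → Params → ℕ
edgeSumΓ Δ P = fΓ Δ P (pair c0 c1) + fΓ Δ P (pair c0 c2) + fΓ Δ P (pair c1 c2)

InA : Complex3 → Params → Set
InA Δ P = (∀ c → 1 ≤ g P c) × (p P ≢ q P) ×
          (∀ S → (∃ λ c → S c ≡ false) → fΓ Δ P S ≤ f Δ S)

MIs : Complex3 → ℕ → Set
MIs Δ v = (∃ λ P → InA Δ P × f₁₂₃Γ Δ P ≡ v) × (∀ P → InA Δ P → f₁₂₃Γ Δ P ≤ v)

InB : Complex3 → Params → Set
InB Δ P = InA Δ P × (∀ P′ → InA Δ P′ → f₁₂₃Γ Δ P′ ≤ f₁₂₃Γ Δ P)

InC : Complex3 → Params → Set
InC Δ P = InB Δ P × (∀ P′ → InB Δ P′ → edgeSumΓ Δ P′ ≤ edgeSumΓ Δ P)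

InD : Complex3 → Params → Set
InD Δ P = InC Δ P ×
  (f₁₂₃Γ Δ P < f Δ (single c0) * f Δ (pair c1 c2)) ×
  (f₁₂₃Γ Δ P < f Δ (single c1) * f Δ (pair c0 c2)) ×
  (f₁₂₃Γ Δ P < f Δ (single c2) * f Δ (pair c0 c1))

-- Every Γ ∈ 𝒜(Δ) satisfies f₁₂₃(Γ) ≤ f₁₂(Γ) f₁₃(Γ) ≤ f₁₂(Δ) f₁₃(Δ), because a facet is
-- determined by its two edges through its colour-1 vertex.  Conversely, b₁(Δ) = 0 means
-- f₁₂ f₁₃ < f₂₃, so the complete tripartite complex with one vertex of colour 1,
-- a = min(f₁₂, f₂) of colour 2 and b = min(f₁₃, f₃) of colour 3 (which is the construction
-- with g = (1, a, b), p = 2, q = 3) lies in 𝒜(Δ) and has at least ab facets.  Now ab is one of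
-- f₁₂f₁₃, f₁₂f₃, f₂f₁₃, f₂f₃: the middle two are excluded because ab ≤ m(Δ) is below the strict
-- bounds defining 𝒟(Δ), and the last because f₂f₃ ≥ f₂₃ > ab.  Hence ab = f₁₂f₁₃ = m(Δ).
module Submission where

open import Defs
open import Data.Bool using (Bool; true; false; if_then_else_; _∧_)
open import Data.Bool.Properties using (∧-identityʳ)
open import Data.Empty using (⊥-elim)
open import Data.Fin using (Fin; toℕ) renaming (zero to f0; suc to fs)
open import Data.Fin.Properties using (toℕ<n)
open import Data.Maybe using (just; nothing)
open import Data.Nat using (ℕ; zero; suc; _+_; _*_; _∸_; _≤_; _<_; _⊓_; _<ᵇ_; _≤ᵇ_; z≤n; s≤s)
open import Data.Nat.Properties
open import Data.Product using (∃; _×_; _,_)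
open import Data.Sum using (_⊎_; inj₁; inj₂)
open import Function using (case_of_)
open import Algebra.Properties.CommutativeSemigroup +-commutativeSemigroup
  using () renaming (interchange to +-interchange)
open import Relation.Nullary.Reflects using (ofʸ; ofⁿ)
open import Relation.Binary.PropositionalEquality
  using (_≡_; refl; sym; trans; cong; cong₂; subst)

-- The paper's colours 1, 2, 3 are c0, c1, c2.
f₂ f₃ f₁₂ f₁₃ f₂₃ : Complex3 → ℕ
f₂ Δ = f Δ (single c1)
f₃ Δ = f Δ (single c2)
f₁₂ Δ = f Δ (pair c0 c1)
f₁₃ Δ = f Δ (pair c0 c2)
f₂₃ Δ = f Δ (pair c1 c2)

colourSet : Bool → Bool → Bool → ColorSet
colourSet x y z f0 = x
colourSet x y z (fs f0) = y
colourSet x y z (fs (fs f0)) = z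

colourSet-η : ∀ (S : ColorSet) c → colourSet (S c0) (S c1) (S c2) c ≡ S c
colourSet-η S f0 = refl
colourSet-η S (fs f0) = refl
colourSet-η S (fs (fs f0)) = refl

𝟙 : Bool → ℕ
𝟙 b = if b then 1 else 0

𝟙≤1 : ∀ b → 𝟙 b ≤ 1
𝟙≤1 true = ≤-refl
𝟙≤1 false = z≤n

𝟙-≤-* : ∀ {x y z} → (x ≡ true → y ≡ true × z ≡ true) → 𝟙 x ≤ 𝟙 y * 𝟙 z
𝟙-≤-* {false} _ = z≤n
𝟙-≤-* {true} x⇒y×z with x⇒y×z refl
... | refl , refl = ≤-refl

𝟙[0<ᵇ]≤ : ∀ K → 𝟙 (0 <ᵇ K) ≤ K
𝟙[0<ᵇ]≤ zero = z≤n
𝟙[0<ᵇ]≤ (suc K) = s≤s z≤n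

if-else-0-≤ : ∀ c K → (if c then K else 0) ≤ K
if-else-0-≤ true K = ≤-refl
if-else-0-≤ false K = z≤n

module _ {m n : ℕ} {A : Set} {x y : A} where

  if-≤ᵇ-yes : m ≤ n → (if m ≤ᵇ n then x else y) ≡ x
  if-≤ᵇ-yes m≤n with m ≤ᵇ n | ≤ᵇ-reflects-≤ m n
  ... | true  | _       = refl
  ... | false | ofⁿ m≰n = ⊥-elim (m≰n m≤n)

  if-≤ᵇ-no : n < m → (if m ≤ᵇ n then x else y) ≡ y
  if-≤ᵇ-no n<m with m ≤ᵇ n | ≤ᵇ-reflects-≤ m n
  ... | true  | ofʸ m≤n = ⊥-elim (<⇒≱ n<m m≤n)
  ... | false | _       = refl

m+[m<ᵇn]≤n : ∀ {m n} → m ≤ n → m + [ m <ᵇ n ]ᵇ ≤ n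
m+[m<ᵇn]≤n {m} {n} m≤n with m <ᵇ n | <ᵇ-reflects-< m n
... | true  | ofʸ m<n = subst (_≤ n) (+-comm 1 m) m<n
... | false | _       = subst (_≤ n) (sym (+-identityʳ m)) m≤n

+-≤-via-∸ : ∀ {m n o} → m ≤ o → n ≤ o ∸ m → m + n ≤ o
+-≤-via-∸ {m} m≤o n≤o∸m = ≤-trans (+-monoʳ-≤ m n≤o∸m) (≤-reflexive (m+[n∸m]≡n m≤o))

+-*-≤ : ∀ a b c d → a * b + c * d ≤ (a + c) * (b + d)
+-*-≤ a b c d = ≤-trans (+-mono-≤ (*-monoʳ-≤ a (m≤m+n b d)) (*-monoʳ-≤ c (m≤n+m d b)))
                        (≤-reflexive (sym (*-distribʳ-+ (b + d) a c)))

⊓-*-⊓-cases : ∀ m n o p →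
  (m ⊓ n) * (o ⊓ p) ≡ m * o ⊎ (m ⊓ n) * (o ⊓ p) ≡ m * p ⊎
  (m ⊓ n) * (o ⊓ p) ≡ n * o ⊎ (m ⊓ n) * (o ⊓ p) ≡ n * p
⊓-*-⊓-cases m n o p with ⊓-sel m n | ⊓-sel o p
... | inj₁ m⊓n≡m | inj₁ o⊓p≡o = inj₁ (cong₂ _*_ m⊓n≡m o⊓p≡o)
... | inj₁ m⊓n≡m | inj₂ o⊓p≡p = inj₂ (inj₁ (cong₂ _*_ m⊓n≡m o⊓p≡p))
... | inj₂ m⊓n≡n | inj₁ o⊓p≡o = inj₂ (inj₂ (inj₁ (cong₂ _*_ m⊓n≡n o⊓p≡o)))
... | inj₂ m⊓n≡n | inj₂ o⊓p≡p = inj₂ (inj₂ (inj₂ (cong₂ _*_ m⊓n≡n o⊓p≡p)))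

-- The omitted `true` branches are impossible: there eq : suc _ ≡ 0.
sqrtSearch≡0⇒< : ∀ a d n → sqrtSearch a d (suc n) ≡ 0 → a < d
sqrtSearch≡0⇒< a d zero eq with 1 * 1 * d ≤ᵇ a | ≤ᵇ-reflects-≤ (1 * 1 * d) a
... | false | ofⁿ d≰a = subst (a <_) (*-identityˡ d) (≰⇒> d≰a)
sqrtSearch≡0⇒< a d (suc n) eq with suc (suc n) * suc (suc n) * d ≤ᵇ a
... | false = sqrtSearch≡0⇒< a d n eq

floorSqrtDiv≡0⇒< : ∀ {a d} → 0 < a → floorSqrtDiv a d ≡ 0 → a < d
floorSqrtDiv≡0⇒< {suc a} {d} _ = sqrtSearch≡0⇒< (suc a) d a

sumFin-cong : ∀ n {u v : Fin n → ℕ} → (∀ i → u i ≡ v i) → sumFin n u ≡ sumFin n v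
sumFin-cong zero u≗v = refl
sumFin-cong (suc n) u≗v = cong₂ _+_ (u≗v f0) (sumFin-cong n (λ i → u≗v (fs i)))

sumFin-mono-≤ : ∀ n {u v : Fin n → ℕ} → (∀ i → u i ≤ v i) → sumFin n u ≤ sumFin n v
sumFin-mono-≤ zero u≤v = z≤n
sumFin-mono-≤ (suc n) u≤v = +-mono-≤ (u≤v f0) (sumFin-mono-≤ n (λ i → u≤v (fs i)))

sumFin-const : ∀ n k → sumFin n (λ _ → k) ≡ n * k
sumFin-const zero k = refl
sumFin-const (suc n) k = cong (k +_) (sumFin-const n k)

sumFin-1 : ∀ n → sumFin n (λ _ → 1) ≡ n
sumFin-1 n = trans (sumFin-const n 1) (*-identityʳ n)

sumFin-≤-* : ∀ n k {u : Fin n → ℕ} → (∀ i → u i ≤ k) → sumFin n u ≤ n * k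
sumFin-≤-* n k u≤k = ≤-trans (sumFin-mono-≤ n u≤k) (≤-reflexive (sumFin-const n k))

sumFin-𝟙≤ : ∀ n (h : Fin n → Bool) → sumFin n (λ i → 𝟙 (h i)) ≤ n
sumFin-𝟙≤ n h = ≤-trans (sumFin-≤-* n 1 (λ i → 𝟙≤1 (h i))) (≤-reflexive (*-identityʳ n))

sumFin-distrib-+ : ∀ n (u v : Fin n → ℕ) → sumFin n (λ i → u i + v i) ≡ sumFin n u + sumFin n v
sumFin-distrib-+ zero u v = refl
sumFin-distrib-+ (suc n) u v =
  trans (cong (u f0 + v f0 +_) (sumFin-distrib-+ n _ _)) (+-interchange (u f0) (v f0) _ _)

sumFin-*ˡ : ∀ n k (u : Fin n → ℕ) → sumFin n (λ i → k * u i) ≡ k * sumFin n u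
sumFin-*ˡ zero k u = sym (*-zeroʳ k)
sumFin-*ˡ (suc n) k u = trans (cong (k * u f0 +_) (sumFin-*ˡ n k _)) (sym (*-distribˡ-+ k (u f0) _))

sumFin-*ʳ : ∀ n k (u : Fin n → ℕ) → sumFin n (λ i → u i * k) ≡ sumFin n u * k
sumFin-*ʳ zero k u = refl
sumFin-*ʳ (suc n) k u = trans (cong (u f0 * k +_) (sumFin-*ʳ n k _)) (sym (*-distribʳ-+ k (u f0) _))

sumFin-sumFin-* : ∀ m n (u : Fin m → ℕ) (v : Fin n → ℕ) →
  sumFin m (λ i → sumFin n (λ j → u i * v j)) ≡ sumFin m u * sumFin n v
sumFin-sumFin-* m n u v =
  trans (sumFin-cong m (λ i → sumFin-*ˡ n (u i) v)) (sumFin-*ʳ m (sumFin n v) u)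

sumFin-*-≤ : ∀ n (u v : Fin n → ℕ) → sumFin n (λ i → u i * v i) ≤ sumFin n u * sumFin n v
sumFin-*-≤ zero u v = z≤n
sumFin-*-≤ (suc n) u v = ≤-trans (+-monoʳ-≤ (u f0 * v f0) (sumFin-*-≤ n _ _))
                                 (+-*-≤ (u f0) (v f0) _ _)

sumFin-split : ∀ m e (h : ℕ → ℕ) →
  sumFin (m + e) (λ i → h (toℕ i)) ≡ sumFin m (λ i → h (toℕ i)) + sumFin e (λ i → h (m + toℕ i))
sumFin-split zero e h = refl
sumFin-split (suc m) e h =
  trans (cong (h 0 +_) (sumFin-split m e (λ k → h (suc k)))) (sym (+-assoc (h 0) _ _))

sumFin-prefix-≤ : ∀ m e (h : ℕ → ℕ) → sumFin m (λ i → h (toℕ i)) ≤ sumFin (m + e) (λ i → h (toℕ i))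
sumFin-prefix-≤ m e h = ≤-trans (m≤m+n _ _) (≤-reflexive (sym (sumFin-split m e h)))

sumFin-<ᵇ-≤ : ∀ n K → sumFin n (λ i → 𝟙 (toℕ i <ᵇ K)) ≤ K
sumFin-<ᵇ-≤ zero K = z≤n
sumFin-<ᵇ-≤ (suc n) zero = sumFin-<ᵇ-≤ n zero
sumFin-<ᵇ-≤ (suc n) (suc K) = s≤s (sumFin-<ᵇ-≤ n K)

sumFin-[]ᵇ-≤ : ∀ c {K} (u : Fin [ c ]ᵇ → ℕ) → (∀ i → u i ≤ K) →
               sumFin [ c ]ᵇ u ≤ (if c then K else 0)
sumFin-[]ᵇ-≤ true u u≤K = ≤-trans (≤-reflexive (+-identityʳ (u f0))) (u≤K f0)
sumFin-[]ᵇ-≤ false u u≤K = z≤n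

-- Edges from one vertex to m old vertices and possibly one new vertex, which is joined to it
-- only if the remaining budget K is positive.
star-≤ : ∀ m c {K o} (h : ℕ → Bool) → (∀ t → h (m + t) ≡ (0 <ᵇ K)) → m ≤ o → K ≤ o ∸ m →
         sumFin (m + [ c ]ᵇ) (λ l → 𝟙 (h (toℕ l))) ≤ o
star-≤ m c {K} h new m≤o K≤o∸m = begin
  sumFin (m + [ c ]ᵇ) (λ l → 𝟙 (h (toℕ l)))
    ≡⟨ sumFin-split m [ c ]ᵇ (λ l → 𝟙 (h l)) ⟩
  sumFin m (λ l → 𝟙 (h (toℕ l))) + sumFin [ c ]ᵇ (λ t → 𝟙 (h (m + toℕ t)))
    ≤⟨ +-mono-≤ (sumFin-𝟙≤ m _) (≤-trans (sumFin-[]ᵇ-≤ c _ newEdge) (if-else-0-≤ c K)) ⟩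
  m + K
    ≤⟨ +-≤-via-∸ m≤o K≤o∸m ⟩
  _ ∎
  where
  open ≤-Reasoning
  newEdge : ∀ t → 𝟙 (h (m + toℕ t)) ≤ K
  newEdge t = subst (λ x → 𝟙 x ≤ K) (sym (new (toℕ t))) (𝟙[0<ᵇ]≤ K)

count-full≤count₁₂*count₁₃ : ∀ {n₁ n₂ n₃} (F : FaceFn n₁ n₂ n₃) →
  (∀ i j k → F (just i) (just j) (just k) ≡ true →
             F (just i) (just j) nothing ≡ true × F (just i) nothing (just k) ≡ true) →
  count F full ≤ count F (pair c0 c1) * count F (pair c0 c2)
count-full≤count₁₂*count₁₃ {n₁} {n₂} {n₃} F edges = begin
  count F full
    ≤⟨ sumFin-mono-≤ n₁ (λ i → sumFin-mono-≤ n₂ (λ j → sumFin-mono-≤ n₃ (λ k →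
         𝟙-≤-* (edges i j k)))) ⟩
  sumFin n₁ (λ i → sumFin n₂ (λ j → sumFin n₃ (λ k → e₁₂ i j * e₁₃ i k)))
    ≡⟨ sumFin-cong n₁ (λ i → sumFin-sumFin-* n₂ n₃ (e₁₂ i) (e₁₃ i)) ⟩
  sumFin n₁ (λ i → sumFin n₂ (e₁₂ i) * sumFin n₃ (e₁₃ i))
    ≤⟨ sumFin-*-≤ n₁ _ _ ⟩
  count F (pair c0 c1) * count F (pair c0 c2) ∎
  where
  open ≤-Reasoning
  e₁₂ : Fin n₁ → Fin n₂ → ℕ
  e₁₂ i j = 𝟙 (F (just i) (just j) nothing)
  e₁₃ : Fin n₁ → Fin n₃ → ℕ
  e₁₃ i k = 𝟙 (F (just i) nothing (just k))

f₁₂₃Γ≤f₁₂*f₁₃ : ∀ {Δ P} → InA Δ P → f₁₂₃Γ Δ P ≤ f₁₂ Δ * f₁₃ Δ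
f₁₂₃Γ≤f₁₂*f₁₃ {Δ} {P} (_ , _ , Γ≤Δ) =
  ≤-trans (count-full≤count₁₂*count₁₃ (Construction.faceΓ Δ P) (λ _ _ _ → ∧-edges _ _ _))
          (*-mono-≤ (Γ≤Δ (pair c0 c1) (c2 , refl)) (Γ≤Δ (pair c0 c2) (c1 , refl)))
  where
  ∧-edges : ∀ x y z → x ∧ y ∧ z ≡ true → x ∧ true ≡ true × y ∧ true ≡ true
  ∧-edges true true true _ = refl , refl

f₂₃≤f₂*f₃ : ∀ Δ → f₂₃ Δ ≤ f₂ Δ * f₃ Δ
f₂₃≤f₂*f₃ Δ = ≤-trans
  (sumFin-mono-≤ (n₂ Δ) (λ j → sumFin-mono-≤ (n₃ Δ) (λ k → 𝟙-≤-* (λ jk →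
    down-closed Δ none same none jk , down-closed Δ none none same jk))))
  (≤-reflexive (sumFin-sumFin-* (n₂ Δ) (n₃ Δ) _ _))

b₁≡0⇒f₁₂f₁₃<f₂₃ : ∀ Δ → AllPositive Δ → b₁ Δ ≡ 0 → f₁₂ Δ * f₁₃ Δ < f₂₃ Δ
b₁≡0⇒f₁₂f₁₃<f₂₃ Δ pos = floorSqrtDiv≡0⇒< (*-mono-≤ (pos (pair c0 c1)) (pos (pair c0 c2)))

tripartite : ℕ → ℕ → Params
tripartite a b = record { g = sizes ; p = c1 ; q = c2 }
  where
  sizes : Fin 3 → ℕ
  sizes f0 = 1
  sizes (fs f0) = a
  sizes (fs (fs f0)) = b

module Tripartite (Δ : Complex3) (a b : ℕ) where
  open Construction Δ (tripartite a b) hiding (fΓ)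
  open ≤-Reasoning

  -- Vertex indices are 0-based, so a (resp. b) is the index of the vertex of colour 2 (resp. 3)
  -- that is added when addP (resp. addQ) holds.
  adj₁₂-old : ∀ {l} → l < a → adj c0 0 c1 l ≡ true
  adj₁₂-old = if-≤ᵇ-no

  adj₁₂-new : ∀ t → adj c0 0 c1 (a + t) ≡ (0 <ᵇ kP c0)
  adj₁₂-new t = if-≤ᵇ-yes (m≤m+n a t)

  adj₁₃-old : ∀ {l} → l < b → adj c0 0 c2 l ≡ true
  adj₁₃-old = if-≤ᵇ-no

  adj₁₃-new : ∀ t → adj c0 0 c2 (b + t) ≡ (0 <ᵇ kQ c0)
  adj₁₃-new t = if-≤ᵇ-yes (m≤m+n b t)

  adj₂₃-old : ∀ {j l} → j < a → l < b → adj c1 j c2 l ≡ true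
  adj₂₃-old j<a l<b = trans (if-≤ᵇ-no l<b) (if-≤ᵇ-no j<a)

  adj₂₃-newRow : ∀ {l} t → l < b → adj c1 (a + t) c2 l ≡ (l <ᵇ kP c2)
  adj₂₃-newRow t l<b = trans (if-≤ᵇ-no l<b) (if-≤ᵇ-yes (m≤m+n a t))

  adj₂₃-newColumn : ∀ j t → adj c1 j c2 (b + t) ≡ (j <ᵇ kQ c1)
  adj₂₃-newColumn j t = if-≤ᵇ-yes (m≤m+n b t)

  facet : ℕ → ℕ → ℕ
  facet j k = 𝟙 (adj c0 0 c1 j ∧ adj c0 0 c2 k ∧ adj c1 j c2 k)

  facet-old : ∀ {j k} → j < a → k < b → facet j k ≡ 1
  facet-old j<a k<b rewrite adj₁₂-old j<a | adj₁₃-old k<b | adj₂₃-old j<a k<b = refl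

  facets-≥ : a * b ≤ count faceΓ full
  facets-≥ = begin
    a * b
      ≡⟨ sym (trans (sumFin-cong a (λ _ → sumFin-1 b)) (sumFin-const a b)) ⟩
    sumFin a (λ _ → sumFin b (λ _ → 1))
      ≡⟨ sumFin-cong a (λ j → sumFin-cong b (λ k → sym (facet-old (toℕ<n j) (toℕ<n k)))) ⟩
    sumFin a (λ j → sumFin b (λ k → facet (toℕ j) (toℕ k)))
      ≤⟨ sumFin-mono-≤ a (λ j → sumFin-prefix-≤ b [ addQ ]ᵇ (facet (toℕ j))) ⟩
    sumFin a (λ j → sumFin (b + [ addQ ]ᵇ) (λ k → facet (toℕ j) (toℕ k)))
      ≤⟨ sumFin-prefix-≤ a [ addP ]ᵇ (λ j → sumFin (b + [ addQ ]ᵇ) (λ k → facet j (toℕ k))) ⟩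
    sumFin (a + [ addP ]ᵇ) (λ j → sumFin (b + [ addQ ]ᵇ) (λ k → facet (toℕ j) (toℕ k)))
      ≡⟨ sym (+-identityʳ _) ⟩
    count faceΓ full ∎

  vertices₂-≤ : a ≤ f₂ Δ → count faceΓ (single c1) ≤ f₂ Δ
  vertices₂-≤ a≤f₂ = ≤-trans (≤-reflexive (sumFin-1 (a + [ addP ]ᵇ))) (m+[m<ᵇn]≤n a≤f₂)

  vertices₃-≤ : b ≤ f₃ Δ → count faceΓ (single c2) ≤ f₃ Δ
  vertices₃-≤ b≤f₃ = ≤-trans (≤-reflexive (sumFin-1 (b + [ addQ ]ᵇ))) (m+[m<ᵇn]≤n b≤f₃)

  edges₁₂-≤ : a ≤ f₁₂ Δ → count faceΓ (pair c0 c1) ≤ f₁₂ Δ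
  edges₁₂-≤ a≤f₁₂ = begin
    count faceΓ (pair c0 c1)
      ≡⟨ trans (+-identityʳ _) (sumFin-cong (a + [ addP ]ᵇ) (λ l → cong 𝟙 (∧-identityʳ _))) ⟩
    sumFin (a + [ addP ]ᵇ) (λ l → 𝟙 (adj c0 0 c1 (toℕ l)))
      ≤⟨ star-≤ a addP (adj c0 0 c1) adj₁₂-new a≤f₁₂
                (subst (λ x → kP c0 ≤ f₁₂ Δ ∸ x) (*-identityʳ a) (m⊓n≤n 1 _)) ⟩
    f₁₂ Δ ∎

  edges₁₃-≤ : b ≤ f₁₃ Δ → count faceΓ (pair c0 c2) ≤ f₁₃ Δ
  edges₁₃-≤ b≤f₁₃ = begin
    count faceΓ (pair c0 c2)
      ≡⟨ trans (+-identityʳ _) (sumFin-cong (b + [ addQ ]ᵇ) (λ l → cong 𝟙 (∧-identityʳ _))) ⟩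
    sumFin (b + [ addQ ]ᵇ) (λ l → 𝟙 (adj c0 0 c2 (toℕ l)))
      ≤⟨ star-≤ b addQ (adj c0 0 c2) adj₁₃-new b≤f₁₃
                (subst (λ x → kQ c0 ≤ f₁₃ Δ ∸ x) (*-identityʳ b) (m⊓n≤n 1 _)) ⟩
    f₁₃ Δ ∎

  edges₂₃-≤ : a * b ≤ f₂₃ Δ → count faceΓ (pair c1 c2) ≤ f₂₃ Δ
  edges₂₃-≤ ab≤f₂₃ = begin
    sumFin (a + [ addP ]ᵇ) (λ j → sumFin (b + [ addQ ]ᵇ) (λ l → e (toℕ j) (toℕ l)))
      ≡⟨ sumFin-cong (a + [ addP ]ᵇ) (λ j → sumFin-split b [ addQ ]ᵇ (e (toℕ j))) ⟩
    sumFin (a + [ addP ]ᵇ) (λ j → oldColumns (toℕ j) + newColumn (toℕ j))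
      ≡⟨ sumFin-distrib-+ (a + [ addP ]ᵇ) _ _ ⟩
    sumFin (a + [ addP ]ᵇ) (λ j → oldColumns (toℕ j)) +
    sumFin (a + [ addP ]ᵇ) (λ j → newColumn (toℕ j))
      ≤⟨ +-mono-≤ oldColumns-≤ newColumn-≤ ⟩
    Epq + kQ c1
      ≤⟨ +-≤-via-∸ Epq≤f₂₃ (m⊓n≤n _ _) ⟩
    f₂₃ Δ ∎
    where
    e : ℕ → ℕ → ℕ
    e j l = 𝟙 (adj c1 j c2 l)
    oldColumns newColumn : ℕ → ℕ
    oldColumns j = sumFin b (λ l → e j (toℕ l))
    newColumn j = sumFin [ addQ ]ᵇ (λ t → e j (b + toℕ t))

    newRow-≤ : ∀ t → oldColumns (a + t) ≤ kP c2
    newRow-≤ t = ≤-trans (≤-reflexive (sumFin-cong b (λ l → cong 𝟙 (adj₂₃-newRow t (toℕ<n l)))))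
                         (sumFin-<ᵇ-≤ b (kP c2))

    oldColumns-≤ : sumFin (a + [ addP ]ᵇ) (λ j → oldColumns (toℕ j)) ≤ Epq
    oldColumns-≤ = ≤-trans (≤-reflexive (sumFin-split a [ addP ]ᵇ oldColumns))
      (+-mono-≤ (sumFin-≤-* a b (λ j → sumFin-𝟙≤ b _))
                (sumFin-[]ᵇ-≤ addP _ (λ t → newRow-≤ (toℕ t))))

    newColumn-≤ : sumFin (a + [ addP ]ᵇ) (λ j → newColumn (toℕ j)) ≤ kQ c1
    newColumn-≤ = ≤-trans
      (sumFin-mono-≤ (a + [ addP ]ᵇ) (λ j → ≤-trans
        (sumFin-[]ᵇ-≤ addQ _ (λ t → ≤-reflexive (cong 𝟙 (adj₂₃-newColumn (toℕ j) (toℕ t)))))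
        (if-else-0-≤ addQ _)))
      (sumFin-<ᵇ-≤ (a + [ addP ]ᵇ) (kQ c1))

    Epq≤f₂₃ : Epq ≤ f₂₃ Δ
    Epq≤f₂₃ = +-≤-via-∸ ab≤f₂₃ (≤-trans (if-else-0-≤ addP _) (m⊓n≤n b _))

  module _ (pos : AllPositive Δ) (a≤f₂ : a ≤ f₂ Δ) (a≤f₁₂ : a ≤ f₁₂ Δ)
           (b≤f₃ : b ≤ f₃ Δ) (b≤f₁₃ : b ≤ f₁₃ Δ) (ab≤f₂₃ : a * b ≤ f₂₃ Δ) where

    proper-≤ : ∀ x y z → (∃ λ c → colourSet x y z c ≡ false) →
               count faceΓ (colourSet x y z) ≤ f Δ (colourSet x y z)
    proper-≤ true true true (f0 , ())
    proper-≤ true true true (fs f0 , ())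
    proper-≤ true true true (fs (fs f0) , ())
    proper-≤ false false false _ = pos (colourSet false false false)
    proper-≤ true false false _ = pos (colourSet true false false)
    proper-≤ false true false _ = vertices₂-≤ a≤f₂
    proper-≤ false false true _ = vertices₃-≤ b≤f₃
    proper-≤ true true false _ = edges₁₂-≤ a≤f₁₂
    proper-≤ true false true _ = edges₁₃-≤ b≤f₁₃
    proper-≤ false true true _ = edges₂₃-≤ ab≤f₂₃

    tripartite-∈A : 1 ≤ a → 1 ≤ b → InA Δ (tripartite a b)
    tripartite-∈A 1≤a 1≤b = sizes-pos , (λ ()) , λ S (c , Sc≡false) →
      proper-≤ (S c0) (S c1) (S c2) (c , trans (colourSet-η S c) Sc≡false)
      where
      sizes-pos : ∀ c → 1 ≤ g (tripartite a b) c
      sizes-pos f0 = ≤-refl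
      sizes-pos (fs f0) = 1≤a
      sizes-pos (fs (fs f0)) = 1≤b

min-product<f₂₃ : ∀ Δ → AllPositive Δ → b₁ Δ ≡ 0 → (f₁₂ Δ ⊓ f₂ Δ) * (f₁₃ Δ ⊓ f₃ Δ) < f₂₃ Δ
min-product<f₂₃ Δ pos b₁≡0 =
  ≤-<-trans (*-mono-≤ (m⊓n≤m (f₁₂ Δ) (f₂ Δ)) (m⊓n≤m (f₁₃ Δ) (f₃ Δ))) (b₁≡0⇒f₁₂f₁₃<f₂₃ Δ pos b₁≡0)

min-tripartite-∈A : ∀ Δ → AllPositive Δ → b₁ Δ ≡ 0 →
                    InA Δ (tripartite (f₁₂ Δ ⊓ f₂ Δ) (f₁₃ Δ ⊓ f₃ Δ))
min-tripartite-∈A Δ pos b₁≡0 =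
  Tripartite.tripartite-∈A Δ (f₁₂ Δ ⊓ f₂ Δ) (f₁₃ Δ ⊓ f₃ Δ) pos
    (m⊓n≤n (f₁₂ Δ) (f₂ Δ)) (m⊓n≤m (f₁₂ Δ) (f₂ Δ)) (m⊓n≤n (f₁₃ Δ) (f₃ Δ)) (m⊓n≤m (f₁₃ Δ) (f₃ Δ))
    (<⇒≤ (min-product<f₂₃ Δ pos b₁≡0))
    (⊓-glb (pos (pair c0 c1)) (pos (single c1))) (⊓-glb (pos (pair c0 c2)) (pos (single c2)))

lemma2p21 : (Δ : Complex3) → AllPositive Δ → b₁ Δ ≡ 0 →
            (∃ λ P → InD Δ P) →
            MIs Δ (f Δ (pair c0 c1) * f Δ (pair c0 c2))
lemma2p21 Δ pos b₁≡0 (P , ((_ , P-max) , _) , _ , P<f₂f₁₃ , P<f₃f₁₂) =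
  case ⊓-*-⊓-cases (f₁₂ Δ) (f₂ Δ) (f₁₃ Δ) (f₃ Δ) of λ where
    (inj₁ ab≡f₁₂f₁₃) →
      (W , W∈A , ≤-antisym (f₁₂₃Γ≤f₁₂*f₁₃ W∈A) (subst (_≤ f₁₂₃Γ Δ W) ab≡f₁₂f₁₃ ab≤W)) ,
      λ _ → f₁₂₃Γ≤f₁₂*f₁₃
    (inj₂ (inj₁ ab≡f₁₂f₃)) →
      ⊥-elim (<⇒≱ P<f₃f₁₂ (subst (_≤ f₁₂₃Γ Δ P) (trans ab≡f₁₂f₃ (*-comm (f₁₂ Δ) (f₃ Δ))) ab≤P))
    (inj₂ (inj₂ (inj₁ ab≡f₂f₁₃))) →
      ⊥-elim (<⇒≱ P<f₂f₁₃ (subst (_≤ f₁₂₃Γ Δ P) ab≡f₂f₁₃ ab≤P))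
    (inj₂ (inj₂ (inj₂ ab≡f₂f₃))) →
      ⊥-elim (<⇒≱ (min-product<f₂₃ Δ pos b₁≡0) (subst (f₂₃ Δ ≤_) (sym ab≡f₂f₃) (f₂₃≤f₂*f₃ Δ)))
  where
  a b : ℕ
  a = f₁₂ Δ ⊓ f₂ Δ
  b = f₁₃ Δ ⊓ f₃ Δ
  W : Params
  W = tripartite a b
  W∈A : InA Δ W
  W∈A = min-tripartite-∈A Δ pos b₁≡0
  ab≤W : a * b ≤ f₁₂₃Γ Δ W
  ab≤W = Tripartite.facets-≥ Δ a b
  ab≤P : a * b ≤ f₁₂₃Γ Δ P
  ab≤P = ≤-trans ab≤W (P-max W W∈A)
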